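{- Let $X$ and $Y$ be sets and let $f:X\to\mathcal L(Y)$ be any function. Then the Kleisli extension $f^\#:\mathcal L(X)\to\mathcal L(Y)$ is a morphism of dcpos. That is, it is monotone, and it preserves least upper bounds of directed families indexed by types in $\mathcal U_0$.
   Context: The ambient theory is intensional Martin-Löf type theory with function extensionality, propositional extensionality and propositional truncation $\|-\|$. There are universes $\mathcal U_0:\mathcal U_1$, and $\Omega$ denotes the type of propositions in $\mathcal U_0$. The lifting of a type $X$ is $\mathcal L(X):=\sum_{P:\Omega}(P\to X)$. The function $\mathrm{isdefined}$ is the first projection, and $\mathrm{value}(P,\varphi)(p):=\varphi(p)$. For a set $X$, $\mathcal L(X)$ is ordered by $l\sqsubseteq m:=(\mathrm{isdefined}(l)\to l=m)$. A family $u:I\to\mathcal L(X)$ is directed if $\|I\|$ holds and $\prod_{i,j:I}\big\|\sum_{k:I}(u_i\sqsubseteq u_k)\times(u_j\sqsubseteq u_k)\big\|$. Every directed family $u:I\to\mathcal L(X)$ with $I:\mathcal U_0$ has least upper bound $\big(\|\sum_{i:I}\mathrm{isdefined}(u_i)\|,\phi\big)$. Here $\phi$ is the unique factorisation through the truncation of the weakly constant map $(i,d)\mapsto\mathrm{value}(u_i)(d)$. For $f:X\to\mathcal L(Y)$, the Kleisli extension is \[f^\#(P,\varphi):=\Big(\sum_{p:P}\mathrm{isdefined}(f(\varphi(p))),\ (p,d)\mapsto \mathrm{value}(f(\varphi(p)))(d)\Big).\] -}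

module Defs where

open import Level using (Level; _⊔_; Setω) renaming (suc to lsuc; zero to lzero)
open import Data.Product using (Σ; Σ-syntax; _×_; _,_; proj₁; proj₂)
open import Relation.Binary.PropositionalEquality using (_≡_; refl; cong)

isProp : ∀ {ℓ} → Set ℓ → Set ℓ
isProp A = (x y : A) → x ≡ y

isSet : ∀ {ℓ} → Set ℓ → Set ℓ
isSet A = (x y : A) → isProp (x ≡ y)

-- Ambient axioms of the paper, taken as explicit hypotheses.
record FunExt : Setω where
  field
    funext : ∀ {a b} {A : Set a} {B : A → Set b} {f g : (x : A) → B x}
           → ((x : A) → f x ≡ g x) → f ≡ g

record PropExt : Setω where
  field
    propext : ∀ {ℓ} {P Q : Set ℓ} → isProp P → isProp Q
            → (P → Q) → (Q → P) → P ≡ Q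

record PropTrunc : Setω where
  field
    ∥_∥      : ∀ {ℓ} → Set ℓ → Set ℓ
    ∣_∣      : ∀ {ℓ} {A : Set ℓ} → A → ∥ A ∥
    ∥∥-isProp : ∀ {ℓ} {A : Set ℓ} → isProp ∥ A ∥
    ∥∥-rec   : ∀ {ℓ ℓ'} {A : Set ℓ} {B : Set ℓ'} → isProp B → (A → B) → ∥ A ∥ → B

-- Ω : propositions in U₀ (= Set)
Ω : Set₁
Ω = Σ[ P ∈ Set ] isProp P

𝓛 : ∀ {ℓ} → Set ℓ → Set (lsuc lzero ⊔ ℓ)
𝓛 X = Σ[ P ∈ Ω ] (proj₁ P → X)

isdefined : ∀ {ℓ} {X : Set ℓ} → 𝓛 X → Set
isdefined ((P , _) , _) = P

value : ∀ {ℓ} {X : Set ℓ} (l : 𝓛 X) → isdefined l → X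
value (_ , φ) p = φ p

Σ-isProp : ∀ {a b} {A : Set a} {B : A → Set b}
         → isProp A → ((x : A) → isProp (B x)) → isProp (Σ A B)
Σ-isProp pA pB (a , b) (a' , b') with pA a a'
... | refl = cong (a ,_) (pB a b b')

_♯ : ∀ {ℓ ℓ'} {X : Set ℓ} {Y : Set ℓ'} → (X → 𝓛 Y) → 𝓛 X → 𝓛 Y
(f ♯) ((P , pP) , φ) =
  ( (Σ[ p ∈ P ] isdefined (f (φ p)))
  , Σ-isProp pP (λ p → proj₂ (proj₁ (f (φ p)))) )
  , λ { (p , d) → value (f (φ p)) d }

_⊑_ : ∀ {ℓ} {X : Set ℓ} → 𝓛 X → 𝓛 X → Set (lsuc lzero ⊔ ℓ)
l ⊑ m = isdefined l → l ≡ m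

isMonotone : ∀ {ℓ ℓ'} {X : Set ℓ} {Y : Set ℓ'} → (𝓛 X → 𝓛 Y) → Set (lsuc lzero ⊔ ℓ ⊔ ℓ')
isMonotone g = ∀ l m → l ⊑ m → g l ⊑ g m

isLub : ∀ {ℓ} {X : Set ℓ} {I : Set} → (I → 𝓛 X) → 𝓛 X → Set (lsuc lzero ⊔ ℓ)
isLub {X = X} {I} u l = ((i : I) → u i ⊑ l) × ((m : 𝓛 X) → ((i : I) → u i ⊑ m) → l ⊑ m)

module _ (pt : PropTrunc) where
  open PropTrunc pt

  isDirected : ∀ {ℓ} {X : Set ℓ} {I : Set} → (I → 𝓛 X) → Set (lsuc lzero ⊔ ℓ)
  isDirected {I = I} u =
    ∥ I ∥ × ((i j : I) → ∥ Σ[ k ∈ I ] ((u i ⊑ u k) × (u j ⊑ u k)) ∥)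

  preservesDirectedLubs : ∀ {ℓ ℓ'} {X : Set ℓ} {Y : Set ℓ'} → (𝓛 X → 𝓛 Y)
                        → Set (lsuc lzero ⊔ ℓ ⊔ ℓ')
  preservesDirectedLubs {X = X} g =
    (I : Set) (u : I → 𝓛 X) → isDirected u → (l : 𝓛 X) → isLub u l
    → isLub (λ i → g (u i)) (g l)

  isDcpoMorphism : ∀ {ℓ ℓ'} {X : Set ℓ} {Y : Set ℓ'} → (𝓛 X → 𝓛 Y)
                 → Set (lsuc lzero ⊔ ℓ ⊔ ℓ')
  isDcpoMorphism g = isMonotone g × preservesDirectedLubs g

-- f♯ l is defined only when l is, which gives monotonicity. For a least upper
-- bound l of u: if f♯ l is defined then so is l, hence (comparing l with the
-- upper bound defined exactly when some u i is) some u i is defined, and then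
-- u i = l, so f♯ l = f♯ (u i) is below every upper bound of f♯ ∘ u. That u i
-- is only known to exist in the truncation, but over a set Y, equality with a
-- defined lifting is equivalent to a proposition, so the truncation can be removed.
module Submission where

open import Defs
open import Data.Product using (Σ; _,_; proj₁; proj₂)
open import Function using (_∘_)
open import Relation.Binary.PropositionalEquality using (_≡_; refl; sym; trans; cong; cong₂; subst)
open import Axiom.UniquenessOfIdentityProofs using (module Constant⇒UIP)

isProp⇒isSet : ∀ {a} {A : Set a} → isProp A → isSet A
isProp⇒isSet {A = A} A-prop _ _ = Constant⇒UIP.≡-irrelevant canonical (λ _ _ → refl)
  where
  canonical : {x y : A} → x ≡ y → x ≡ y
  canonical {x} {y} _ = trans (sym (A-prop x x)) (A-prop x y)

isProp-isProp : FunExt → ∀ {a} {A : Set a} → isProp (isProp A)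
isProp-isProp fe p q = funext λ x → funext λ y → isProp⇒isSet p x y (p x y) (q x y)
  where open FunExt fe

module _ {a} {Z : Set a} where

  value-≡ : {l m : 𝓛 Z} → l ≡ m → (dl : isdefined l) (dm : isdefined m)
          → value l dl ≡ value m dm
  value-≡ {l = (_ , P-prop) , φ} refl dl dm = cong φ (P-prop dl dm)

  𝓛-≡ : FunExt → PropExt → (l m : 𝓛 Z) (dl : isdefined l) (dm : isdefined m)
      → value l dl ≡ value m dm → l ≡ m
  𝓛-≡ fe pe ((P , P-prop) , φ) ((Q , Q-prop) , ψ) dl dm φ≡ψ
    with PropExt.propext pe P-prop Q-prop (λ _ → dm) (λ _ → dl)
  ... | refl = cong₂ (λ P-prop' φ' → (P , P-prop') , φ')
                     (isProp-isProp fe P-prop Q-prop)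
                     (FunExt.funext fe λ p →
                        trans (cong φ (P-prop p dl)) (trans φ≡ψ (cong ψ (Q-prop dm p))))

♯-monotone : ∀ {ℓ ℓ'} {X : Set ℓ} {Y : Set ℓ'} (f : X → 𝓛 Y) → isMonotone (f ♯)
♯-monotone f l m l⊑m (p , _) = cong (f ♯) (l⊑m p)

module _ (fe : FunExt) (pe : PropExt) (pt : PropTrunc) where
  open PropTrunc pt

  ∥≡∥⇒≡ : ∀ {a} {Z : Set a} → isSet Z → (l m : 𝓛 Z) → isdefined l → ∥ l ≡ m ∥ → l ≡ m
  ∥≡∥⇒≡ Z-set l m dl =
    (λ { (dm , values-≡) → 𝓛-≡ fe pe l m dl dm values-≡ })
    ∘ ∥∥-rec agreement-isProp (λ l≡m → subst isdefined l≡m dl , value-≡ l≡m dl _)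
    where
    agreement : Set _
    agreement = Σ (isdefined m) (λ dm → value l dl ≡ value m dm)

    agreement-isProp : isProp agreement
    agreement-isProp = Σ-isProp (proj₂ (proj₁ m)) (λ _ → Z-set _ _)

  isLub-isdefined : ∀ {a} {Z : Set a} {I : Set} {u : I → 𝓛 Z} {l : 𝓛 Z}
                  → isLub u l → isdefined l → ∥ Σ I (isdefined ∘ u) ∥
  isLub-isdefined {u = u} {l} (upper , least) dl = subst isdefined (least witness bounds dl) dl
    where
    witness : 𝓛 _
    witness = (∥ Σ _ (isdefined ∘ u) ∥ , ∥∥-isProp) , λ _ → value l dl

    bounds : ∀ i → u i ⊑ witness
    bounds i di = 𝓛-≡ fe pe (u i) witness di ∣ i , di ∣ (value-≡ (upper i di) di dl)

  ♯-preservesLubs : ∀ {ℓ ℓ'} {X : Set ℓ} {Y : Set ℓ'} → isSet Y → (f : X → 𝓛 Y)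
                  → {I : Set} {u : I → 𝓛 X} {l : 𝓛 X}
                  → isLub u l → isLub (f ♯ ∘ u) ((f ♯) l)
  ♯-preservesLubs Y-set f {u = u} {l} lub@(upper , _) =
    (λ i → ♯-monotone f (u i) l (upper i)) , least
    where
    least : ∀ m → (∀ i → (f ♯) (u i) ⊑ m) → (f ♯) l ⊑ m
    least m bounded d@(dl , _) =
      ∥≡∥⇒≡ Y-set ((f ♯) l) m d
        (∥∥-rec ∥∥-isProp (λ { (i , di) → ∣ through i (upper i di) ∣ }) (isLub-isdefined lub dl))
      where
      through : ∀ i → u i ≡ l → (f ♯) l ≡ m
      through i uᵢ≡l = trans f♯l≡f♯uᵢ (bounded i (subst isdefined f♯l≡f♯uᵢ d))
        where
        f♯l≡f♯uᵢ : (f ♯) l ≡ (f ♯) (u i)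
        f♯l≡f♯uᵢ = cong (f ♯) (sym uᵢ≡l)

theorem4p11 : (fe : FunExt) (pe : PropExt) (pt : PropTrunc)
    → ∀ {ℓ ℓ'} (X : Set ℓ) (Y : Set ℓ') → isSet X → isSet Y
    → (f : X → 𝓛 Y) → isDcpoMorphism pt (f ♯)
theorem4p11 fe pe pt X Y _ Y-set f =
  ♯-monotone f , λ _ _ _ _ → ♯-preservesLubs fe pe pt Y-set f
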